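{- Let $n\ge 6$ and $\pi=(5^2,4^i,3^j,2^{n-2-i-j})$ with $i,j\ge 0$, $i+j\ge 4$, and $\sigma(\pi)$ even. Then $\pi$ is potentially $K_6-C_5$-graphic if and only if $\pi\notin\{(5^2,3^4),\ (5^2,3^4,2),\ (5^2,3^6),\ (5^2,4,3^4)\}$.
   Context: A non-increasing sequence of nonnegative integers is potentially $H$-graphic if some simple graph with that degree sequence contains $H$ as a subgraph. $\sigma(\pi)$ is the sum of the terms of $\pi$. $r^t$ denotes $t$ terms equal to $r$. $K_6-C_5$ denotes $K_6$ with the edges of a 5-cycle on five of its vertices removed. -}

module Defs where

open import Data.Nat using (ℕ; zero; suc; _+_)
open import Data.Bool using (Bool; true; false)
open import Data.Fin using (Fin; zero; suc)
open import Data.List using (List; _∷_; []; _++_; replicate; length; lookup; map; allFin)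
open import Data.Nat.ListAction using (sum)
open import Data.Product using (Σ; _×_; ∃; _,_)
open import Function.Definitions using (Injective)
open import Relation.Binary.PropositionalEquality using (_≡_; refl)

record Graph (n : ℕ) : Set where
  field
    adj    : Fin n → Fin n → Bool
    adj-sym : ∀ u v → adj u v ≡ adj v u
    adj-irrefl : ∀ v → adj v v ≡ false

open Graph public

deg : ∀ {n} → Graph n → Fin n → ℕ
deg {n} G v = sum (map (λ u → Data.Bool.if_then_else_ (adj G v u) 1 0) (allFin n))
  where import Data.Bool

ContainsSubgraph : ∀ {n m} → Graph n → Graph m → Set
ContainsSubgraph {n} {m} G H =
  Σ (Fin m → Fin n) λ f → Injective _≡_ _≡_ f ×
    (∀ a b → adj H a b ≡ true → adj G (f a) (f b) ≡ true)

HasDegreeSequence : (π : List ℕ) → Graph (length π) → Set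
HasDegreeSequence π G = ∀ v → deg {length π} G v ≡ lookup π v

PotentiallyGraphic : ∀ {m} → Graph m → List ℕ → Set
PotentiallyGraphic {m} H π =
  Σ (Graph (length π)) λ G → HasDegreeSequence π G × ContainsSubgraph {length π} {m} G H

-- K6 - C5: vertices 0..5, all edges except the 5-cycle 1-2-3-4-5-1
k6c5-adj : Fin 6 → Fin 6 → Bool
k6c5-adj zero zero = false
k6c5-adj zero (suc zero) = true
k6c5-adj zero (suc (suc zero)) = true
k6c5-adj zero (suc (suc (suc zero))) = true
k6c5-adj zero (suc (suc (suc (suc zero)))) = true
k6c5-adj zero (suc (suc (suc (suc (suc zero))))) = true
k6c5-adj (suc zero) zero = true
k6c5-adj (suc zero) (suc zero) = false
k6c5-adj (suc zero) (suc (suc zero)) = false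
k6c5-adj (suc zero) (suc (suc (suc zero))) = true
k6c5-adj (suc zero) (suc (suc (suc (suc zero)))) = true
k6c5-adj (suc zero) (suc (suc (suc (suc (suc zero))))) = false
k6c5-adj (suc (suc zero)) zero = true
k6c5-adj (suc (suc zero)) (suc zero) = false
k6c5-adj (suc (suc zero)) (suc (suc zero)) = false
k6c5-adj (suc (suc zero)) (suc (suc (suc zero))) = false
k6c5-adj (suc (suc zero)) (suc (suc (suc (suc zero)))) = true
k6c5-adj (suc (suc zero)) (suc (suc (suc (suc (suc zero))))) = true
k6c5-adj (suc (suc (suc zero))) zero = true
k6c5-adj (suc (suc (suc zero))) (suc zero) = true
k6c5-adj (suc (suc (suc zero))) (suc (suc zero)) = false
k6c5-adj (suc (suc (suc zero))) (suc (suc (suc zero))) = false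
k6c5-adj (suc (suc (suc zero))) (suc (suc (suc (suc zero)))) = false
k6c5-adj (suc (suc (suc zero))) (suc (suc (suc (suc (suc zero))))) = true
k6c5-adj (suc (suc (suc (suc zero)))) zero = true
k6c5-adj (suc (suc (suc (suc zero)))) (suc zero) = true
k6c5-adj (suc (suc (suc (suc zero)))) (suc (suc zero)) = true
k6c5-adj (suc (suc (suc (suc zero)))) (suc (suc (suc zero))) = false
k6c5-adj (suc (suc (suc (suc zero)))) (suc (suc (suc (suc zero)))) = false
k6c5-adj (suc (suc (suc (suc zero)))) (suc (suc (suc (suc (suc zero))))) = false
k6c5-adj (suc (suc (suc (suc (suc zero))))) zero = true
k6c5-adj (suc (suc (suc (suc (suc zero))))) (suc zero) = false
k6c5-adj (suc (suc (suc (suc (suc zero))))) (suc (suc zero)) = true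
k6c5-adj (suc (suc (suc (suc (suc zero))))) (suc (suc (suc zero))) = true
k6c5-adj (suc (suc (suc (suc (suc zero))))) (suc (suc (suc (suc zero)))) = false
k6c5-adj (suc (suc (suc (suc (suc zero))))) (suc (suc (suc (suc (suc zero))))) = false

k6c5-sym : ∀ u v → k6c5-adj u v ≡ k6c5-adj v u
k6c5-sym zero zero = refl
k6c5-sym zero (suc zero) = refl
k6c5-sym zero (suc (suc zero)) = refl
k6c5-sym zero (suc (suc (suc zero))) = refl
k6c5-sym zero (suc (suc (suc (suc zero)))) = refl
k6c5-sym zero (suc (suc (suc (suc (suc zero))))) = refl
k6c5-sym (suc zero) zero = refl
k6c5-sym (suc zero) (suc zero) = refl
k6c5-sym (suc zero) (suc (suc zero)) = refl
k6c5-sym (suc zero) (suc (suc (suc zero))) = refl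
k6c5-sym (suc zero) (suc (suc (suc (suc zero)))) = refl
k6c5-sym (suc zero) (suc (suc (suc (suc (suc zero))))) = refl
k6c5-sym (suc (suc zero)) zero = refl
k6c5-sym (suc (suc zero)) (suc zero) = refl
k6c5-sym (suc (suc zero)) (suc (suc zero)) = refl
k6c5-sym (suc (suc zero)) (suc (suc (suc zero))) = refl
k6c5-sym (suc (suc zero)) (suc (suc (suc (suc zero)))) = refl
k6c5-sym (suc (suc zero)) (suc (suc (suc (suc (suc zero))))) = refl
k6c5-sym (suc (suc (suc zero))) zero = refl
k6c5-sym (suc (suc (suc zero))) (suc zero) = refl
k6c5-sym (suc (suc (suc zero))) (suc (suc zero)) = refl
k6c5-sym (suc (suc (suc zero))) (suc (suc (suc zero))) = refl
k6c5-sym (suc (suc (suc zero))) (suc (suc (suc (suc zero)))) = refl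
k6c5-sym (suc (suc (suc zero))) (suc (suc (suc (suc (suc zero))))) = refl
k6c5-sym (suc (suc (suc (suc zero)))) zero = refl
k6c5-sym (suc (suc (suc (suc zero)))) (suc zero) = refl
k6c5-sym (suc (suc (suc (suc zero)))) (suc (suc zero)) = refl
k6c5-sym (suc (suc (suc (suc zero)))) (suc (suc (suc zero))) = refl
k6c5-sym (suc (suc (suc (suc zero)))) (suc (suc (suc (suc zero)))) = refl
k6c5-sym (suc (suc (suc (suc zero)))) (suc (suc (suc (suc (suc zero))))) = refl
k6c5-sym (suc (suc (suc (suc (suc zero))))) zero = refl
k6c5-sym (suc (suc (suc (suc (suc zero))))) (suc zero) = refl
k6c5-sym (suc (suc (suc (suc (suc zero))))) (suc (suc zero)) = refl
k6c5-sym (suc (suc (suc (suc (suc zero))))) (suc (suc (suc zero))) = refl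
k6c5-sym (suc (suc (suc (suc (suc zero))))) (suc (suc (suc (suc zero)))) = refl
k6c5-sym (suc (suc (suc (suc (suc zero))))) (suc (suc (suc (suc (suc zero))))) = refl

k6c5-irr : ∀ v → k6c5-adj v v ≡ false
k6c5-irr zero = refl
k6c5-irr (suc zero) = refl
k6c5-irr (suc (suc zero)) = refl
k6c5-irr (suc (suc (suc zero))) = refl
k6c5-irr (suc (suc (suc (suc zero)))) = refl
k6c5-irr (suc (suc (suc (suc (suc zero))))) = refl

K6-C5 : Graph 6
K6-C5 = record { adj = k6c5-adj ; adj-sym = k6c5-sym ; adj-irrefl = k6c5-irr }

seq : ℕ → ℕ → ℕ → List ℕ
seq i j k = 5 ∷ 5 ∷ replicate i 4 ++ replicate j 3 ++ replicate k 2

-- Write H = K6 - C5: a hub of degree 5 and five leaves of degree 3. In a realization G of π containing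
-- H via f, the hub goes to a vertex of degree 5, and a leaf sent to a vertex of degree at most 3 is
-- saturated: all its G-edges are images of H-edges. So a vertex outside the image of f is adjacent only
-- to unsaturated vertices other than f(hub); in the three exceptional sequences with more than six
-- terms there are fewer of these than its degree. In (5²,3⁴) f is onto and the second vertex of degree 5,
-- the image of a leaf, would be adjacent to the saturated image of a leaf it misses in H.
--
-- Conversely, σ(π) even forces j even, and every other sequence is obtained from one of thirteen explicit
-- realizations. Ten of them carry a path u v w z of edges of G outside the copy of H; such a path
-- survives subdividing wz by a new vertex (adding a 2), subdividing uv and wz by one new vertex (adding
-- a 4), and subdividing them by two new vertices which are then joined (adding 3, 3).

module Submission where

open import Defs
open import Data.Nat using (ℕ; _+_; _∸_; _≤_; _≥_; _%_)
open import Data.List using (List; _∷_; [])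
open import Data.Nat.ListAction using (sum)
open import Data.List.Membership.Propositional using (_∉_)
open import Data.Product using (_×_)
open import Function.Bundles using (_⇔_)
open import Relation.Binary.PropositionalEquality using (_≡_)

open import Data.Bool using (Bool; true; false; if_then_else_; _∧_; _∨_; not)
open import Data.Bool.ListAction using (any)
open import Data.Bool.Properties using (∧-comm; ∨-comm; ∨-zeroʳ; ∨-identityʳ) renaming (_≟_ to _≟ᵇ_)
open import Data.Empty using (⊥; ⊥-elim)
open import Data.Fin using (Fin; zero; suc; punchIn; punchOut; toℕ; #_; _↑ˡ_)
open import Data.Fin.Permutation as Perm using (Permutation; _⟨$⟩ʳ_; _⟨$⟩ˡ_; inverseˡ; inverseʳ)
open import Data.Fin.Properties
  using (0≢1+n; punchIn-punchOut; punchInᵢ≢i; punchOut-injective; suc-injective; any?; all?; ¬∀⟶∃¬; injective⇒≤)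
  renaming (_≟_ to _≟ᶠ_)
open import Data.List using (length; lookup; tabulate; replicate; _++_)
open import Data.List.Membership.Propositional using (_∈_)
open import Data.List.Properties using (map-tabulate)
open import Data.List.Relation.Binary.Permutation.Homogeneous using (onIndices)
open import Data.List.Relation.Binary.Permutation.Propositional using (_↭_; ↭-refl; ↭-sym; ↭-trans; prep; ↭⇒↭ₛ)
open import Data.List.Relation.Binary.Permutation.Propositional.Properties using (shift; ++⁺ˡ)
import Data.List.Relation.Unary.Any as Any
open Any using (here; there)
open import Data.Nat using (zero; suc; _*_; _/_; _<_; _≤?_; _≡ᵇ_; z≤n; s≤s)
open import Data.Nat.DivMod using (m≡m%n+[m/n]*n; [m+kn]%n≡m%n)
open import Data.Nat.ListAction.Properties using (sum-++)
open import Data.Nat.Properties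
  using ( ≤-refl; ≤-trans; ≤-reflexive; <-irrefl; +-mono-≤; +-monoʳ-≤; m≤n+m; n≤1+n
        ; +-comm; +-identityʳ; +-0-commutativeMonoid)
  renaming (_≟_ to _≟ℕ_)
open import Data.Nat.Tactic.RingSolver using (solve-∀)
open import Data.Product using (∃; _,_; proj₁; proj₂; swap)
open import Data.Product.Properties using (,-injectiveˡ; ,-injectiveʳ; ≡-dec)
open import Data.Sum using (_⊎_; inj₁; inj₂; map₁)
import Data.Vec as Vec
open Vec using (_∷_; [])
open import Data.Vec.Functional using (Vector) renaming (_∷_ to _◂_)
open import Function using (_∘_)
open import Function.Bundles using (mk⇔)
open import Function.Definitions using (Injective)
open import Relation.Binary.PropositionalEquality
open import Relation.Nullary using (¬_; Dec; yes; no; does)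
open import Relation.Nullary.Decidable using (True; toWitness; from-yes; map′; ¬?; _×-dec_; _⊎-dec_; _→-dec_)
open import Data.List.Relation.Binary.Permutation.Setoid.Properties (setoid ℕ) using (onIndices-lookup)
open import Algebra.Properties.CommutativeMonoid.Sum +-0-commutativeMonoid
  using (sum-syntax; sum-cong-≗; sum-remove; ∑-distrib-+; ∑-permute)
  renaming (sum to ∑)

true≢false : true ≢ false
true≢false ()

Bool→ℕ : Bool → ℕ
Bool→ℕ b = if b then 1 else 0

Bool→ℕ-≤1 : ∀ b → Bool→ℕ b ≤ 1
Bool→ℕ-≤1 true = ≤-refl
Bool→ℕ-≤1 false = z≤n

δ : ∀ {n} → Fin n → Fin n → ℕ
δ w u = Bool→ℕ (does (w ≟ᶠ u))

δ-refl : ∀ {n} (w : Fin n) → δ w w ≡ 1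
δ-refl w with w ≟ᶠ w
... | yes _ = refl
... | no w≢w = ⊥-elim (w≢w refl)

∑-mono-≤ : ∀ {n} {g h : Vector ℕ n} → (∀ i → g i ≤ h i) → ∑ g ≤ ∑ h
∑-mono-≤ {zero} g≤h = z≤n
∑-mono-≤ {suc n} g≤h = +-mono-≤ (g≤h zero) (∑-mono-≤ (g≤h ∘ suc))

∑-mono-< : ∀ {n} {g h : Vector ℕ n} → (∀ i → g i ≤ h i) → ∀ p → g p < h p → ∑ g < ∑ h
∑-mono-< {suc n} {g} {h} g≤h p gp<hp
  rewrite sum-remove {i = p} g | sum-remove {i = p} h =
  +-mono-≤ gp<hp (∑-mono-≤ (g≤h ∘ punchIn p))

∑-const-1 : ∀ n → ∑[ i < n ] 1 ≡ n
∑-const-1 zero = refl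
∑-const-1 (suc n) = cong suc (∑-const-1 n)

∑-zero : ∀ {n} {g : Vector ℕ n} → (∀ i → g i ≡ 0) → ∑ g ≡ 0
∑-zero {zero} g≡0 = refl
∑-zero {suc n} g≡0 = cong₂ _+_ (g≡0 zero) (∑-zero (g≡0 ∘ suc))

δ-≢ : ∀ {n} {w u : Fin n} → w ≢ u → δ w u ≡ 0
δ-≢ {w = w} {u} w≢u with w ≟ᶠ u
... | yes w≡u = ⊥-elim (w≢u w≡u)
... | no _ = refl

∑-δ : ∀ {n} (w : Fin n) → ∑ (δ w) ≡ 1
∑-δ {suc n} w =
  trans (sum-remove {i = w} (δ w))
        (cong₂ _+_ (δ-refl w) (∑-zero (λ i → δ-≢ (λ w≡ → punchInᵢ≢i w i (sym w≡)))))

∑-injective-≤ : ∀ {m n} (f : Fin m → Fin n) → Injective _≡_ _≡_ f → (g : Vector ℕ n) → ∑ (g ∘ f) ≤ ∑ g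
∑-injective-≤ {zero} f f-inj g = z≤n
∑-injective-≤ {suc m} {zero} f f-inj g with f zero
... | ()
∑-injective-≤ {suc m} {suc n} f f-inj g rewrite sum-remove {i = f zero} g =
  +-monoʳ-≤ (g (f zero))
    (≤-trans (≤-reflexive (sum-cong-≗ (λ b → cong g (sym (punchIn-punchOut (f₀≢ b))))))
             (∑-injective-≤ f′ f′-inj (g ∘ punchIn (f zero))))
  where
  f₀≢ : ∀ b → f zero ≢ f (suc b)
  f₀≢ b eq with f-inj eq
  ... | ()
  f′ : Fin m → Fin n
  f′ b = punchOut (f₀≢ b)
  f′-inj : Injective _≡_ _≡_ f′
  f′-inj eq = suc-injective (f-inj (punchOut-injective (f₀≢ _) (f₀≢ _) eq))

◂-injective : ∀ {m n} {z : Fin n} {f : Fin m → Fin n} → Injective _≡_ _≡_ f → (∀ b → f b ≢ z) →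
  Injective _≡_ _≡_ (z ◂ f)
◂-injective f-inj z∉f {zero} {zero} eq = refl
◂-injective f-inj z∉f {zero} {suc b} eq = ⊥-elim (z∉f b (sym eq))
◂-injective f-inj z∉f {suc a} {zero} eq = ⊥-elim (z∉f a eq)
◂-injective f-inj z∉f {suc a} {suc b} eq = cong suc (f-inj eq)

injective⇒surjective : ∀ {n} (f : Fin n → Fin n) → Injective _≡_ _≡_ f → ∀ u → ∃ λ b → f b ≡ u
injective⇒surjective {n} f f-inj u with any? (λ b → f b ≟ᶠ u)
... | yes hit = hit
... | no miss = ⊥-elim (<-irrefl refl (injective⇒≤ (◂-injective f-inj (λ b eq → miss (b , eq)))))

covers-all-but : ∀ {m} {f : Fin m → Fin (suc m)} {z} → Injective _≡_ _≡_ f → (∀ b → f b ≢ z) →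
  ∀ u → u ≢ z → ∃ λ b → f b ≡ u
covers-all-but {f = f} {z} f-inj z∉f u u≢z with injective⇒surjective (z ◂ f) (◂-injective f-inj z∉f) u
... | zero  , z≡u  = ⊥-elim (u≢z (sym z≡u))
... | suc b , fb≡u = b , fb≡u

outside-image : ∀ {m n} (f : Fin m → Fin n) → Injective _≡_ _≡_ f → m < n → ∃ λ z → ∀ b → f b ≢ z
outside-image {m} {n} f f-inj m<n with all? (λ u → any? (λ b → f b ≟ᶠ u))
... | yes onto = ⊥-elim (<-irrefl refl (≤-trans m<n (injective⇒≤ {f = preimage} preimage-inj)))
  where
  preimage : Fin n → Fin m
  preimage u = proj₁ (onto u)
  preimage-inj : Injective _≡_ _≡_ preimage
  preimage-inj {u} {v} eq = trans (sym (proj₂ (onto u))) (trans (cong f eq) (proj₂ (onto v)))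
... | no ¬onto with ¬∀⟶∃¬ n _ (λ u → any? (λ b → f b ≟ᶠ u)) ¬onto
...   | z , z∉f = z , λ b eq → z∉f (b , eq)

deg≡∑ : ∀ {n} (G : Graph n) v → deg G v ≡ ∑[ u < n ] Bool→ℕ (adj G v u)
deg≡∑ {n} G v = trans (cong sum (map-tabulate {n = n} (λ u → u) (λ u → Bool→ℕ (adj G v u)))) (sum-tabulate n _)
  where
  sum-tabulate : ∀ n (h : Fin n → ℕ) → sum (tabulate h) ≡ ∑ h
  sum-tabulate zero h = refl
  sum-tabulate (suc n) h = cong (h zero +_) (sum-tabulate n (h ∘ suc))

deg-+-∑-≤ : ∀ {n} (G : Graph n) v (h k : Vector ℕ n) → (∀ u → Bool→ℕ (adj G v u) + h u ≤ k u) →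
  deg G v + ∑ h ≤ ∑ k
deg-+-∑-≤ G v h k bound rewrite deg≡∑ G v =
  ≤-trans (≤-reflexive (sym (∑-distrib-+ (λ u → Bool→ℕ (adj G v u)) h))) (∑-mono-≤ bound)

occurrences : ∀ {n} → List (Fin n) → Vector ℕ n
occurrences []      u = 0
occurrences (w ∷ L) u = δ w u + occurrences L u

∑-occurrences : ∀ {n} (L : List (Fin n)) → ∑ (occurrences L) ≡ length L
∑-occurrences {n} []      = ∑-zero {n} (λ _ → refl)
∑-occurrences (w ∷ L) =
  trans (∑-distrib-+ (δ w) (occurrences L)) (cong₂ _+_ (∑-δ w) (∑-occurrences L))

occurrences-∈ : ∀ {n} {L : List (Fin n)} {u} → u ∈ L → 1 ≤ occurrences L u
occurrences-∈ {L = _ ∷ L} {u} (here refl) rewrite δ-refl u = s≤s z≤n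
occurrences-∈ {L = w ∷ L} {u} (there u∈L) = ≤-trans (occurrences-∈ u∈L) (m≤n+m _ (δ w u))

deg-<-length : ∀ {n} (G : Graph n) v (L : List (Fin n)) {c} →
  (∀ u → adj G v u ≡ true → u ∈ L) → c ∈ L → adj G v c ≡ false → suc (deg G v) ≤ length L
deg-<-length {n} G v L {c} nbrs⊆L c∈L v≁c =
  subst₂ _≤_ (trans (cong (deg G v +_) (∑-δ c)) (+-comm (deg G v) 1)) (∑-occurrences L)
    (deg-+-∑-≤ G v (δ c) (occurrences L) bound)
  where
  bound : ∀ u → Bool→ℕ (adj G v u) + δ c u ≤ occurrences L u
  bound u with c ≟ᶠ u
  ... | yes refl rewrite v≁c = occurrences-∈ c∈L
  ... | no _ with adj G v u in v~u
  ...   | true  = ≤-trans (≤-reflexive (+-comm 1 0)) (occurrences-∈ (nbrs⊆L u v~u))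
  ...   | false = z≤n

non-neighbour⇒2+deg≤ : ∀ {n} (G : Graph n) {v u} → u ≢ v → adj G v u ≡ false → 2 + deg G v ≤ n
non-neighbour⇒2+deg≤ {n} G {v} {u} u≢v v≁u =
  subst₂ _≤_ (trans (cong (deg G v +_) ∑h≡2) (+-comm (deg G v) 2)) (∑-const-1 n)
    (deg-+-∑-≤ G v (λ x → δ v x + δ u x) (λ _ → 1) bound)
  where
  ∑h≡2 : ∑[ x < n ] (δ v x + δ u x) ≡ 2
  ∑h≡2 = trans (∑-distrib-+ (δ v) (δ u)) (cong₂ _+_ (∑-δ v) (∑-δ u))
  bound : ∀ x → Bool→ℕ (adj G v x) + (δ v x + δ u x) ≤ 1
  bound x with v ≟ᶠ x | u ≟ᶠ x
  ... | yes refl | yes refl = ⊥-elim (u≢v refl)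
  ... | yes refl | no _ rewrite adj-irrefl G v = ≤-refl
  ... | no _ | yes refl rewrite v≁u = ≤-refl
  ... | no _ | no _ = ≤-trans (≤-reflexive (+-comm (Bool→ℕ (adj G v x)) 0)) (Bool→ℕ-≤1 (adj G v x))

∑-adj-injective-≤-deg : ∀ {k n} (G : Graph n) v (g : Fin k → Fin n) → Injective _≡_ _≡_ g →
  ∑[ b < k ] Bool→ℕ (adj G v (g b)) ≤ deg G v
∑-adj-injective-≤-deg G v g g-inj rewrite deg≡∑ G v = ∑-injective-≤ g g-inj (λ u → Bool→ℕ (adj G v u))

EdgePreserving : ∀ {m n} → Graph m → Graph n → (Fin m → Fin n) → Set
EdgePreserving H G f = ∀ a b → adj H a b ≡ true → adj G (f a) (f b) ≡ true

module Embedding {m n} (H : Graph m) (G : Graph n) (f : Fin m → Fin n) (f-inj : Injective _≡_ _≡_ f)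
  (f-edge : EdgePreserving H G f) where

  open import Data.List.Membership.DecPropositional (_≟ᶠ_ {n}) using (_∈?_)

  edge-≤ : ∀ a b → Bool→ℕ (adj H a b) ≤ Bool→ℕ (adj G (f a) (f b))
  edge-≤ a b with adj H a b in a~b
  ... | true rewrite f-edge a b a~b = ≤-refl
  ... | false = z≤n

  ∑-edge-≥ : ∀ a → deg H a ≤ ∑[ b < m ] Bool→ℕ (adj G (f a) (f b))
  ∑-edge-≥ a rewrite deg≡∑ H a = ∑-mono-≤ (edge-≤ a)

  deg-≤ : ∀ a → deg H a ≤ deg G (f a)
  deg-≤ a = ≤-trans (∑-edge-≥ a) (∑-adj-injective-≤-deg G (f a) f f-inj)

  Saturated : Fin m → Set
  Saturated a = deg G (f a) ≤ deg H a

  -- Otherwise one of the two inequalities behind deg-≤ would be strict.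
  saturated-neighbour : ∀ {a u} → Saturated a → adj G (f a) u ≡ true → ∃ λ b → f b ≡ u × adj H a b ≡ true
  saturated-neighbour {a} {u} sat fa~u with any? (λ b → f b ≟ᶠ u)
  ... | no u∉f = ⊥-elim (<-irrefl refl (≤-trans (s≤s (≤-trans sat (∑-edge-≥ a)))
          (u-counted (∑-adj-injective-≤-deg G (f a) (u ◂ f) (◂-injective f-inj λ b eq → u∉f (b , eq))))))
    where
    u-counted : ∑[ b < suc m ] Bool→ℕ (adj G (f a) ((u ◂ f) b)) ≤ deg G (f a) →
      suc (∑[ b < m ] Bool→ℕ (adj G (f a) (f b))) ≤ deg G (f a)
    u-counted rewrite fa~u = λ p → p
  ... | yes (b , refl) with adj H a b in a~b
  ...   | true = b , refl , a~b
  ...   | false = ⊥-elim (<-irrefl refl (≤-trans (s≤s sat) (≤-trans strict (∑-adj-injective-≤-deg G (f a) f f-inj))))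
    where
    strict : suc (deg H a) ≤ ∑[ b < m ] Bool→ℕ (adj G (f a) (f b))
    strict rewrite deg≡∑ H a =
      ∑-mono-< (edge-≤ a) b (subst₂ (λ x y → Bool→ℕ x < Bool→ℕ y) (sym a~b) (sym fa~u) ≤-refl)

  saturated-∉-image : ∀ {a z} → Saturated a → (∀ b → f b ≢ z) → adj G (f a) z ≡ false
  saturated-∉-image {a} {z} sat z∉f with adj G (f a) z in fa~z
  ... | false = refl
  ... | true = ⊥-elim (z∉f _ (proj₁ (proj₂ (saturated-neighbour sat fa~z))))

  -- A vertex outside the image is adjacent to no saturated vertex, so only to vertices of L.
  outsider-deg-< : ∀ {z a} (L : List (Fin n)) → (∀ b → f b ≢ z) → f a ∈ L → Saturated a →
    (∀ u → u ≢ z → u ∉ L → ∃ λ b → f b ≡ u × Saturated b) → suc (deg G z) ≤ length L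
  outsider-deg-< {z} {a} L z∉f fa∈L sat-a cover =
    deg-<-length G z L nbrs⊆L fa∈L (trans (adj-sym G z (f a)) (saturated-∉-image sat-a z∉f))
    where
    nbrs⊆L : ∀ u → adj G z u ≡ true → u ∈ L
    nbrs⊆L u z~u with u ∈? L
    ... | yes u∈L = u∈L
    ... | no u∉L with cover u (λ { refl → true≢false (trans (sym z~u) (adj-irrefl G z)) }) u∉L
    ...   | b , refl , sat-b =
      ⊥-elim (true≢false (trans (sym z~u) (trans (adj-sym G z (f b)) (saturated-∉-image sat-b z∉f))))

deg-K6-C5-≥3 : ∀ b → 3 ≤ deg K6-C5 b
deg-K6-C5-≥3 = from-yes (all? λ b → 3 ≤? deg K6-C5 b)

K6-C5-non-neighbour : ∀ a → a ≢ zero → ∃ λ b → b ≢ zero × b ≢ a × adj K6-C5 a b ≡ false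
K6-C5-non-neighbour zero a≢0 = ⊥-elim (a≢0 refl)
K6-C5-non-neighbour (suc zero) _ = # 2 , (λ ()) , (λ ()) , refl
K6-C5-non-neighbour (suc (suc zero)) _ = # 3 , (λ ()) , (λ ()) , refl
K6-C5-non-neighbour (suc (suc (suc zero))) _ = # 4 , (λ ()) , (λ ()) , refl
K6-C5-non-neighbour (suc (suc (suc (suc zero)))) _ = # 5 , (λ ()) , (λ ()) , refl
K6-C5-non-neighbour (suc (suc (suc (suc (suc zero))))) _ = # 1 , (λ ()) , (λ ()) , refl

module K6-C5-Realization {π : List ℕ} (G : Graph (length π)) (dg : HasDegreeSequence π G)
  (f : Fin 6 → Fin (length π)) (f-inj : Injective _≡_ _≡_ f)
  (f-edge : EdgePreserving K6-C5 G f) where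

  open Embedding K6-C5 G f f-inj f-edge public

  saturated-≤3 : ∀ b → lookup π (f b) ≤ 3 → Saturated b
  saturated-≤3 b ≤3 = ≤-trans (≤-reflexive (dg (f b))) (≤-trans ≤3 (deg-K6-C5-≥3 b))

  hub-∈ : ∀ {L} → (∀ u → u ∈ L ⊎ lookup π u ≤ 3) → f zero ∈ L
  hub-∈ small with small (f zero)
  ... | inj₁ f0∈L = f0∈L
  ... | inj₂ ≤3 = ⊥-elim (<-irrefl refl
    (≤-trans (deg-≤ zero) (≤-trans (≤-reflexive (dg (f zero))) (≤-trans ≤3 (s≤s (s≤s (s≤s z≤n)))))))

  -- f a would be adjacent to the saturated image of a leaf that a misses in K6-C5.
  full-leaf-impossible : ∀ {a} → a ≢ zero → suc (deg G (f a)) ≡ length π →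
    (∀ b → b ≢ zero → b ≢ a → Saturated b) → ⊥
  full-leaf-impossible {a} a≢0 full saturated with K6-C5-non-neighbour a a≢0
  ... | b , b≢0 , b≢a , a≁b with adj G (f b) (f a) in fb~fa
  ...   | false = <-irrefl refl (≤-trans (≤-reflexive (cong suc (sym full)))
                    (non-neighbour⇒2+deg≤ G (b≢a ∘ f-inj) (trans (adj-sym G (f a) (f b)) fb~fa)))
  ...   | true with saturated-neighbour (saturated b b≢0 b≢a) fb~fa
  ...     | a′ , fa′≡fa , b~a′ = true≢false
    (trans (sym b~a′) (trans (cong (adj K6-C5 b) (f-inj fa′≡fa)) (trans (adj-sym K6-C5 b a) a≁b)))

  outsider-lookup-< : ∀ {z} L → (∀ u → u ∈ L ⊎ lookup π u ≤ 3) → (∀ u → lookup π u ≤ 5) →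
    (∀ b → f b ≢ z) → (∀ u → u ≢ z → u ∉ L → ∃ λ b → f b ≡ u) → suc (lookup π z) ≤ length L
  outsider-lookup-< {z} L small ≤5 z∉f cover =
    subst (λ d → suc d ≤ length L) (dg z)
      (outsider-deg-< L z∉f (hub-∈ small) (≤-trans (≤-reflexive (dg (f zero))) (≤5 (f zero))) saturated)
    where
    saturated : ∀ u → u ≢ z → u ∉ L → ∃ λ b → f b ≡ u × Saturated b
    saturated u u≢z u∉L with cover u u≢z u∉L
    ... | b , refl with small (f b)
    ...   | inj₁ fb∈L = ⊥-elim (u∉L fb∈L)
    ...   | inj₂ ≤3 = b , refl , saturated-≤3 b ≤3

≤3-outside? : (π : List ℕ) (L : List (Fin (length π))) → Dec (∀ u → u ∈ L ⊎ lookup π u ≤ 3)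
≤3-outside? π L = all? λ u → Any.any? (u ≟ᶠ_) L ⊎-dec lookup π u ≤? 3

≤5? : (π : List ℕ) → Dec (∀ u → lookup π u ≤ 5)
≤5? π = all? λ u → lookup π u ≤? 5

≥3? : (π : List ℕ) → Dec (∀ u → 3 ≤ lookup π u)
≥3? π = all? λ u → 3 ≤? lookup π u

¬potentially-5²3⁴2 : ¬ PotentiallyGraphic K6-C5 (seq 0 4 1)
¬potentially-5²3⁴2 (G , dg , f , f-inj , f-edge) =
  <-irrefl refl (outsider-lookup-< L (from-yes (≤3-outside? (seq 0 4 1) L)) (from-yes (≤5? (seq 0 4 1))) z∉f
    (λ u u≢z _ → covers-all-but f-inj z∉f u u≢z))
  where
  open K6-C5-Realization G dg f f-inj f-edge
  L : List (Fin 7)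
  L = # 0 ∷ # 1 ∷ []
  z∉f : ∀ b → f b ≢ # 6
  z∉f b fb≡z = <-irrefl refl
    (≤-trans (deg-K6-C5-≥3 b) (≤-trans (deg-≤ b) (≤-reflexive (trans (cong (deg G) fb≡z) (dg (# 6))))))

¬potentially-5²43⁴ : ¬ PotentiallyGraphic K6-C5 (seq 1 4 0)
¬potentially-5²43⁴ (G , dg , f , f-inj , f-edge) with outside-image f f-inj ≤-refl
... | z , z∉f = <-irrefl refl (≤-trans (s≤s (from-yes (≥3? (seq 1 4 0)) z))
       (outsider-lookup-< L (from-yes (≤3-outside? (seq 1 4 0) L)) (from-yes (≤5? (seq 1 4 0))) z∉f
         (λ u u≢z _ → covers-all-but f-inj z∉f u u≢z)))
  where
  open K6-C5-Realization G dg f f-inj f-edge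
  L : List (Fin 7)
  L = # 0 ∷ # 1 ∷ # 2 ∷ []

-- Of the two vertices z, y outside the image, y joins the unsaturated vertices in L.
¬potentially-5²3⁶ : ¬ PotentiallyGraphic K6-C5 (seq 0 6 0)
¬potentially-5²3⁶ (G , dg , f , f-inj , f-edge) with outside-image f f-inj (n≤1+n 7)
... | z , z∉f with outside-image (z ◂ f) (◂-injective f-inj z∉f) ≤-refl
...   | y , y∉zf = <-irrefl refl (≤-trans (s≤s (from-yes (≥3? (seq 0 6 0)) z))
         (outsider-lookup-< L (λ u → map₁ there (from-yes (≤3-outside? (seq 0 6 0) (# 0 ∷ # 1 ∷ [])) u))
           (from-yes (≤5? (seq 0 6 0))) z∉f cover))
  where
  open K6-C5-Realization G dg f f-inj f-edge
  L : List (Fin 8)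
  L = y ∷ # 0 ∷ # 1 ∷ []
  cover : ∀ u → u ≢ z → u ∉ L → ∃ λ b → f b ≡ u
  cover u u≢z u∉L with covers-all-but (◂-injective f-inj z∉f) y∉zf u (λ u≡y → u∉L (here u≡y))
  ... | zero , z≡u = ⊥-elim (u≢z (sym z≡u))
  ... | suc b , fb≡u = b , fb≡u

-- With six vertices f is onto, so the second vertex of degree 5 is the image of a leaf.
¬potentially-5²3⁴ : ¬ PotentiallyGraphic K6-C5 (seq 0 4 0)
¬potentially-5²3⁴ (G , dg , f , f-inj , f-edge) = hubs (hub-∈ (from-yes (≤3-outside? π L)))
  where
  open K6-C5-Realization G dg f f-inj f-edge
  π : List ℕ
  π = seq 0 4 0
  L : List (Fin 6)
  L = # 0 ∷ # 1 ∷ []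
  leaves-≤3 : ∀ u → u ≢ # 0 → u ≢ # 1 → lookup π u ≤ 3
  leaves-≤3 u u≢0 u≢1 with from-yes (≤3-outside? π L) u
  ... | inj₁ (here u≡0) = ⊥-elim (u≢0 u≡0)
  ... | inj₁ (there (here u≡1)) = ⊥-elim (u≢1 u≡1)
  ... | inj₂ ≤3 = ≤3
  second-hub : ∀ {c} d → f zero ≡ c → d ≢ c → lookup π d ≡ 5 →
    (∀ u → u ≢ c → u ≢ d → lookup π u ≤ 3) → ⊥
  second-hub {c} d f0≡c d≢c deg-d leaves with injective⇒surjective f f-inj d
  ... | a , refl = full-leaf-impossible a≢0 (cong suc (trans (dg (f a)) deg-d)) saturated
    where
    a≢0 : a ≢ zero
    a≢0 a≡0 = d≢c (trans (cong f a≡0) f0≡c)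
    saturated : ∀ b → b ≢ zero → b ≢ a → Saturated b
    saturated b b≢0 b≢a =
      saturated-≤3 b (leaves (f b) (λ fb≡c → b≢0 (f-inj (trans fb≡c (sym f0≡c)))) (b≢a ∘ f-inj))
  hubs : f zero ∈ L → ⊥
  hubs (here f0≡0) = second-hub (# 1) f0≡0 (λ ()) refl leaves-≤3
  hubs (there (here f0≡1)) = second-hub (# 0) f0≡1 (λ ()) refl (λ u u≢1 u≢0 → leaves-≤3 u u≢0 u≢1)

_==_ : ∀ {n} → Fin n → Fin n → Bool
x == y = does (x ≟ᶠ y)

joins : ∀ {n} → Fin n → Fin n → Fin n → Fin n → Bool
joins x y p q = (x == p ∧ y == q) ∨ (y == p ∧ x == q)

joins-sym : ∀ {n} (x y p q : Fin n) → joins x y p q ≡ joins x y q p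
joins-sym x y p q
  rewrite ∧-comm (x == p) (y == q) | ∧-comm (y == p) (x == q) = ∨-comm (y == q ∧ x == p) (x == q ∧ y == p)

joins-irrefl : ∀ {n} {x y : Fin n} → x ≢ y → ∀ p → joins x y p p ≡ false
joins-irrefl {x = x} {y} x≢y p with x ≟ᶠ p | y ≟ᶠ p
... | yes refl | yes refl = ⊥-elim (x≢y refl)
... | yes refl | no _ = refl
... | no _ | yes refl = refl
... | no _ | no _ = refl

joins⇒ : ∀ {n} {x y p q : Fin n} → joins x y p q ≡ true → (p , q) ≡ (x , y) ⊎ (p , q) ≡ (y , x)
joins⇒ {x = x} {y} {p} {q} j with x ≟ᶠ p | y ≟ᶠ q | y ≟ᶠ p | x ≟ᶠ q
... | yes refl | yes refl | _ | _ = inj₁ refl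
... | _ | _ | yes refl | yes refl = inj₂ refl
... | yes _ | no _ | yes _ | no _ = ⊥-elim (true≢false (sym j))
... | yes _ | no _ | no _ | _ = ⊥-elim (true≢false (sym j))
... | no _ | _ | yes _ | no _ = ⊥-elim (true≢false (sym j))
... | no _ | _ | no _ | _ = ⊥-elim (true≢false (sym j))

∑-joins : ∀ {n} {x y : Fin n} → x ≢ y → ∀ p → ∑[ q < n ] Bool→ℕ (joins x y p q) ≡ δ x p + δ y p
∑-joins {n} {x} {y} x≢y p with x ≟ᶠ p | y ≟ᶠ p
... | yes refl | yes refl = ⊥-elim (x≢y refl)
... | yes refl | no _ = trans (sum-cong-≗ λ q → cong Bool→ℕ (∨-identityʳ (y == q))) (∑-δ y)
... | no _ | yes refl = ∑-δ x
... | no _ | no _ = ∑-zero {n} λ _ → refl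

joins-≢ : ∀ {n} {x y p q : Fin n} → (p , q) ≢ (x , y) → (p , q) ≢ (y , x) → joins x y p q ≡ false
joins-≢ {x = x} {y} {p} {q} ≢xy ≢yx with joins x y p q in j
... | false = refl
... | true with joins⇒ j
...   | inj₁ ≡xy = ⊥-elim (≢xy ≡xy)
...   | inj₂ ≡yx = ⊥-elim (≢yx ≡yx)

addEdge : ∀ {n} (G : Graph n) (x y : Fin n) → x ≢ y → Graph n
addEdge G x y x≢y = record
  { adj        = λ p q → adj G p q ∨ joins x y p q
  ; adj-sym    = λ p q → cong₂ _∨_ (adj-sym G p q) (joins-sym x y p q)
  ; adj-irrefl = λ p → cong₂ _∨_ (adj-irrefl G p) (joins-irrefl x≢y p)
  }

removeEdge : ∀ {n} (G : Graph n) (x y : Fin n) → Graph n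
removeEdge G x y = record
  { adj        = λ p q → adj G p q ∧ not (joins x y p q)
  ; adj-sym    = λ p q → cong₂ _∧_ (adj-sym G p q) (cong not (joins-sym x y p q))
  ; adj-irrefl = λ p → cong (_∧ not (joins x y p p)) (adj-irrefl G p)
  }

addEdge-⊇ : ∀ {n} (G : Graph n) {x y} (x≢y : x ≢ y) {p q} → adj G p q ≡ true → adj (addEdge G x y x≢y) p q ≡ true
addEdge-⊇ G x≢y p~q rewrite p~q = refl

addEdge-new : ∀ {n} (G : Graph n) {x y} (x≢y : x ≢ y) → adj (addEdge G x y x≢y) x y ≡ true
addEdge-new G {x} {y} x≢y with x ≟ᶠ x | y ≟ᶠ y
... | yes _ | yes _ = ∨-zeroʳ (adj G x y)
... | no x≢x | _ = ⊥-elim (x≢x refl)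
... | _ | no y≢y = ⊥-elim (y≢y refl)

removeEdge-keep : ∀ {n} (G : Graph n) {x y p q} → adj G p q ≡ true → (p , q) ≢ (x , y) → (p , q) ≢ (y , x) →
  adj (removeEdge G x y) p q ≡ true
removeEdge-keep G p~q ≢xy ≢yx rewrite p~q | joins-≢ ≢xy ≢yx = refl

Bool→ℕ-∨ : ∀ a b → (b ≡ true → a ≡ false) → Bool→ℕ (a ∨ b) ≡ Bool→ℕ a + Bool→ℕ b
Bool→ℕ-∨ true true disjoint = ⊥-elim (true≢false (disjoint refl))
Bool→ℕ-∨ true false _ = refl
Bool→ℕ-∨ false _ _ = refl

Bool→ℕ-∧-not : ∀ a b → (b ≡ true → a ≡ true) → Bool→ℕ a ≡ Bool→ℕ (a ∧ not b) + Bool→ℕ b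
Bool→ℕ-∧-not true true _ = refl
Bool→ℕ-∧-not true false _ = refl
Bool→ℕ-∧-not false true b⇒a = ⊥-elim (true≢false (sym (b⇒a refl)))
Bool→ℕ-∧-not false false _ = refl

joins-adj : ∀ {n} (G : Graph n) {x y p q} → joins x y p q ≡ true → adj G p q ≡ adj G x y
joins-adj G {x} {y} {p} {q} j with joins⇒ {x = x} {y} {p} {q} j
... | inj₁ refl = refl
... | inj₂ refl = adj-sym G _ _

deg-addEdge : ∀ {n} (G : Graph n) {x y} (x≢y : x ≢ y) → adj G x y ≡ false →
  ∀ p → deg (addEdge G x y x≢y) p ≡ deg G p + (δ x p + δ y p)
deg-addEdge {n} G {x} {y} x≢y x≁y p = begin
  deg (addEdge G x y x≢y) p
    ≡⟨ deg≡∑ (addEdge G x y x≢y) p ⟩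
  ∑[ q < n ] Bool→ℕ (adj G p q ∨ joins x y p q)
    ≡⟨ sum-cong-≗ (λ q → Bool→ℕ-∨ (adj G p q) _ (λ j → trans (joins-adj G j) x≁y)) ⟩
  ∑[ q < n ] (Bool→ℕ (adj G p q) + Bool→ℕ (joins x y p q))
    ≡⟨ ∑-distrib-+ (λ q → Bool→ℕ (adj G p q)) (λ q → Bool→ℕ (joins x y p q)) ⟩
  ∑[ q < n ] Bool→ℕ (adj G p q) + ∑[ q < n ] Bool→ℕ (joins x y p q)
    ≡⟨ cong₂ _+_ (sym (deg≡∑ G p)) (∑-joins x≢y p) ⟩
  deg G p + (δ x p + δ y p) ∎
  where open ≡-Reasoning

deg-removeEdge : ∀ {n} (G : Graph n) {x y} → x ≢ y → adj G x y ≡ true →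
  ∀ p → deg G p ≡ deg (removeEdge G x y) p + (δ x p + δ y p)
deg-removeEdge {n} G {x} {y} x≢y x~y p = begin
  deg G p
    ≡⟨ deg≡∑ G p ⟩
  ∑[ q < n ] Bool→ℕ (adj G p q)
    ≡⟨ sum-cong-≗ (λ q → Bool→ℕ-∧-not (adj G p q) _ (λ j → trans (joins-adj G j) x~y)) ⟩
  ∑[ q < n ] (Bool→ℕ (adj G p q ∧ not (joins x y p q)) + Bool→ℕ (joins x y p q))
    ≡⟨ ∑-distrib-+ (λ q → Bool→ℕ (adj G p q ∧ not (joins x y p q))) (λ q → Bool→ℕ (joins x y p q)) ⟩
  ∑[ q < n ] Bool→ℕ (adj G p q ∧ not (joins x y p q)) + ∑[ q < n ] Bool→ℕ (joins x y p q)
    ≡⟨ cong₂ _+_ (sym (deg≡∑ (removeEdge G x y) p)) (∑-joins x≢y p) ⟩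
  deg (removeEdge G x y) p + (δ x p + δ y p) ∎
  where open ≡-Reasoning

reroute : ∀ {n} (G : Graph n) (x w z : Fin n) → x ≢ w → x ≢ z → Graph n
reroute G x w z x≢w x≢z = addEdge (addEdge (removeEdge G w z) x w x≢w) x z x≢z

module _ {n} (G : Graph n) {x w z : Fin n} (x≢w : x ≢ w) (x≢z : x ≢ z) where

  private
    R  = removeEdge G w z
    A  = addEdge R x w x≢w
    G′ = reroute G x w z x≢w x≢z

  reroute-keep : ∀ {p q} → adj G p q ≡ true → (p , q) ≢ (w , z) → (p , q) ≢ (z , w) → adj G′ p q ≡ true
  reroute-keep p~q ≢wz ≢zw = addEdge-⊇ A x≢z (addEdge-⊇ R x≢w (removeEdge-keep G p~q ≢wz ≢zw))

  reroute-new-w : adj G′ x w ≡ true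
  reroute-new-w = addEdge-⊇ A x≢z (addEdge-new R x≢w)

  reroute-new-z : adj G′ x z ≡ true
  reroute-new-z = addEdge-new A x≢z

  deg-reroute : w ≢ z → adj G w z ≡ true → adj G x w ≡ false → adj G x z ≡ false →
    ∀ p → deg G′ p ≡ deg G p + (δ x p + δ x p)
  deg-reroute w≢z w~z x≁w x≁z p = begin
    deg G′ p
      ≡⟨ deg-addEdge A x≢z A-x≁z p ⟩
    deg A p + (δ x p + δ z p)
      ≡⟨ cong (_+ (δ x p + δ z p)) (deg-addEdge R x≢w R-x≁w p) ⟩
    deg R p + (δ x p + δ w p) + (δ x p + δ z p)
      ≡⟨ rearrange (deg R p) (δ x p) (δ w p) (δ z p) ⟩
    deg R p + (δ w p + δ z p) + (δ x p + δ x p)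
      ≡⟨ cong (_+ (δ x p + δ x p)) (sym (deg-removeEdge G w≢z w~z p)) ⟩
    deg G p + (δ x p + δ x p) ∎
    where
    open ≡-Reasoning
    R-x≁w : adj R x w ≡ false
    R-x≁w rewrite x≁w = refl
    A-x≁z : adj A x z ≡ false
    A-x≁z rewrite x≁z = joins-≢ {x = x} {w} {x} {z} (λ eq → w≢z (sym (cong proj₂ eq))) (λ eq → x≢w (cong proj₁ eq))
    rearrange : ∀ r a b c → r + (a + b) + (a + c) ≡ r + (b + c) + (a + a)
    rearrange = solve-∀

withIsolated : ∀ {n} → Graph n → Graph (suc n)
withIsolated {n} G = record { adj = adj′ ; adj-sym = adj′-sym ; adj-irrefl = adj′-irrefl }
  where
  adj′ : Fin (suc n) → Fin (suc n) → Bool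
  adj′ (suc p) (suc q) = adj G p q
  adj′ _       _       = false
  adj′-sym : ∀ p q → adj′ p q ≡ adj′ q p
  adj′-sym zero    zero    = refl
  adj′-sym zero    (suc q) = refl
  adj′-sym (suc p) zero    = refl
  adj′-sym (suc p) (suc q) = adj-sym G p q
  adj′-irrefl : ∀ p → adj′ p p ≡ false
  adj′-irrefl zero    = refl
  adj′-irrefl (suc p) = adj-irrefl G p

withIsolated-degrees : ∀ {π} {G : Graph (length π)} → HasDegreeSequence π G →
  HasDegreeSequence (0 ∷ π) (withIsolated G)
withIsolated-degrees {π} {G} degrees zero = trans (deg≡∑ (withIsolated G) zero) (∑-zero {length π} λ _ → refl)
withIsolated-degrees {π} {G} degrees (suc p) = trans (deg≡∑ (withIsolated G) (suc p)) (trans (sym (deg≡∑ G p)) (degrees p))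

reroute-x-nonadjacent : ∀ {n} (G : Graph n) {x w z : Fin n} (x≢w : x ≢ w) (x≢z : x ≢ z) {q} →
  adj G x q ≡ false → q ≢ w → q ≢ z → adj (reroute G x w z x≢w x≢z) x q ≡ false
reroute-x-nonadjacent G {x} {w} {z} x≢w x≢z {q} x≁q q≢w q≢z rewrite x≁q
  | joins-≢ {x = x} {w} {x} {q} (λ eq → q≢w (cong proj₂ eq)) (λ eq → x≢w (cong proj₁ eq))
  | joins-≢ {x = x} {z} {x} {q} (λ eq → q≢z (cong proj₂ eq)) (λ eq → x≢z (cong proj₁ eq)) = refl

suc-≢ : ∀ {n} {x y : Fin n} → x ≢ y → suc x ≢ suc y
suc-≢ x≢y = x≢y ∘ suc-injective

-- An edge of G that is not the image of an edge of H, so it may be rerouted without losing the copy of H.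
record FreeEdge {m n} (H : Graph m) (G : Graph n) (f : Fin m → Fin n) (x y : Fin n) : Set where
  constructor _,_
  field
    edge      : adj G x y ≡ true
    not-image : ∀ a b → adj H a b ≡ true → (f a , f b) ≢ (x , y)

module _ {m} {H : Graph m} where

  FreeEdge-sym : ∀ {n} {G : Graph n} {f x y} → FreeEdge H G f x y → FreeEdge H G f y x
  FreeEdge-sym {G = G} {x = x} {y} (x~y , free) =
    trans (adj-sym G y x) x~y , λ a b a~b eq → free b a (trans (adj-sym H b a) a~b) (cong swap eq)

  FreeEdge-withIsolated : ∀ {n} {G : Graph n} {f x y} → FreeEdge H G f x y →
    FreeEdge H (withIsolated G) (suc ∘ f) (suc x) (suc y)
  FreeEdge-withIsolated (x~y , free) =
    x~y , λ a b a~b eq → free a b a~b (cong₂ _,_ (suc-injective (,-injectiveˡ eq)) (suc-injective (,-injectiveʳ eq)))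

  module _ {n} (G : Graph n) {x w z : Fin n} (x≢w : x ≢ w) (x≢z : x ≢ z) {f : Fin m → Fin n} where

    private
      G′ = reroute G x w z x≢w x≢z

    FreeEdge-reroute : ∀ {p q} → FreeEdge H G f p q → p ≢ w → p ≢ z → FreeEdge H G′ f p q
    FreeEdge-reroute (p~q , free) p≢w p≢z =
      reroute-keep G x≢w x≢z p~q (p≢w ∘ ,-injectiveˡ) (p≢z ∘ ,-injectiveˡ) , free

    FreeEdge-reroute-w : (∀ a → f a ≢ x) → FreeEdge H G′ f x w
    FreeEdge-reroute-w x∉f = reroute-new-w G x≢w x≢z , λ a b _ eq → x∉f a (,-injectiveˡ eq)

    FreeEdge-reroute-z : (∀ a → f a ≢ x) → FreeEdge H G′ f x z
    FreeEdge-reroute-z x∉f = reroute-new-z G x≢w x≢z , λ a b _ eq → x∉f a (,-injectiveˡ eq)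

    EdgePreserving-reroute : EdgePreserving H G f → FreeEdge H G f w z → EdgePreserving H G′ f
    EdgePreserving-reroute f-edge (_ , free) a b a~b =
      reroute-keep G x≢w x≢z (f-edge a b a~b) (free a b a~b) (free b a (trans (adj-sym H b a) a~b) ∘ cong swap)

reroute-head-degrees : ∀ {k π} {G : Graph (suc (length π))} {w z} → HasDegreeSequence (k ∷ π) G →
  w ≢ z → adj G w z ≡ true → (0≢w : zero ≢ w) (0≢z : zero ≢ z) →
  adj G zero w ≡ false → adj G zero z ≡ false →
  HasDegreeSequence (2 + k ∷ π) (reroute G zero w z 0≢w 0≢z)
reroute-head-degrees {k} {G = G} degrees w≢z w~z 0≢w 0≢z 0≁w 0≁z zero =
  trans (deg-reroute G 0≢w 0≢z w≢z w~z 0≁w 0≁z zero) (trans (cong (_+ 2) (degrees zero)) (+-comm k 2))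
reroute-head-degrees {G = G} degrees w≢z w~z 0≢w 0≢z 0≁w 0≁z (suc p) =
  trans (deg-reroute G 0≢w 0≢z w≢z w~z 0≁w 0≁z (suc p)) (trans (+-identityʳ _) (degrees (suc p)))

record FreePathRealization {m} (H : Graph m) (π : List ℕ) : Set where
  field
    G       : Graph (length π)
    degrees : HasDegreeSequence π G
    f       : Fin m → Fin (length π)
    f-inj   : Injective _≡_ _≡_ f
    f-edge  : EdgePreserving H G f
    u v w z : Fin (length π)
    u≢v : u ≢ v
    u≢w : u ≢ w
    u≢z : u ≢ z
    v≢w : v ≢ w
    v≢z : v ≢ z
    w≢z : w ≢ z
    uv-free : FreeEdge H G f u v
    vw-free : FreeEdge H G f v w
    wz-free : FreeEdge H G f w z

module _ {m} {H : Graph m} where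

  realization⇒potentiallyGraphic : ∀ {π} → FreePathRealization H π → PotentiallyGraphic H π
  realization⇒potentiallyGraphic R = G , degrees , f , f-inj , f-edge
    where open FreePathRealization R

  -- A new vertex subdivides the edge wz.
  extend₂ : ∀ {π} → FreePathRealization H π → FreePathRealization H (2 ∷ π)
  extend₂ {π} R = record
    { G = G′ ; degrees = degrees′ ; f = suc ∘ f ; f-inj = f-inj ∘ suc-injective ; f-edge = f-edge′
    ; u = suc u ; v = suc v ; w = suc w ; z = zero
    ; u≢v = suc-≢ u≢v ; u≢w = suc-≢ u≢w ; u≢z = λ () ; v≢w = suc-≢ v≢w ; v≢z = λ () ; w≢z = λ ()
    ; uv-free = FreeEdge-reroute G₀ 0≢1+n 0≢1+n (FreeEdge-withIsolated uv-free) (suc-≢ u≢w) (suc-≢ u≢z)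
    ; vw-free = FreeEdge-reroute G₀ 0≢1+n 0≢1+n (FreeEdge-withIsolated vw-free) (suc-≢ v≢w) (suc-≢ v≢z)
    ; wz-free = FreeEdge-sym (FreeEdge-reroute-w G₀ 0≢1+n 0≢1+n λ _ ())
    }
    where
    open FreePathRealization R
    G₀ : Graph (suc (length π))
    G₀ = withIsolated G
    G′ : Graph (suc (length π))
    G′ = reroute G₀ zero (suc w) (suc z) 0≢1+n 0≢1+n
    degrees′ : HasDegreeSequence (2 ∷ π) G′
    degrees′ = reroute-head-degrees {G = G₀} (withIsolated-degrees {G = G} degrees)
      (suc-≢ w≢z) (FreeEdge.edge wz-free) 0≢1+n 0≢1+n refl refl
    f-edge′ : EdgePreserving H G′ (suc ∘ f)
    f-edge′ = EdgePreserving-reroute G₀ 0≢1+n 0≢1+n f-edge (FreeEdge-withIsolated wz-free)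

  -- A new vertex subdivides both uv and wz.
  extend₄ : ∀ {π} → FreePathRealization H π → FreePathRealization H (4 ∷ π)
  extend₄ {π} R = record
    { G = G₂ ; degrees = degrees₂ ; f = suc ∘ f ; f-inj = f-inj ∘ suc-injective ; f-edge = f-edge₂
    ; u = suc u ; v = zero ; w = suc v ; z = suc w
    ; u≢v = λ () ; u≢w = suc-≢ u≢v ; u≢z = suc-≢ u≢w ; v≢w = λ () ; v≢z = λ () ; w≢z = suc-≢ v≢w
    ; uv-free = keep₂ (FreeEdge-sym (FreeEdge-reroute-w G₀ 0≢1+n 0≢1+n λ _ ())) (suc-≢ u≢w) (suc-≢ u≢z)
    ; vw-free = keep₂ (FreeEdge-reroute-z G₀ 0≢1+n 0≢1+n λ _ ()) 0≢1+n 0≢1+n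
    ; wz-free = keep₂ (FreeEdge-sym (keep₁ (FreeEdge-sym (FreeEdge-withIsolated vw-free))
                  (suc-≢ (≢-sym u≢w)) (suc-≢ (≢-sym v≢w)))) (suc-≢ v≢w) (suc-≢ v≢z)
    }
    where
    open FreePathRealization R
    G₀ G₁ G₂ : Graph (suc (length π))
    G₀ = withIsolated G
    G₁ = reroute G₀ zero (suc u) (suc v) 0≢1+n 0≢1+n
    G₂ = reroute G₁ zero (suc w) (suc z) 0≢1+n 0≢1+n
    keep₁ : ∀ {p q} → FreeEdge H G₀ (suc ∘ f) p q → p ≢ suc u → p ≢ suc v → FreeEdge H G₁ (suc ∘ f) p q
    keep₁ = FreeEdge-reroute G₀ 0≢1+n 0≢1+n
    keep₂ : ∀ {p q} → FreeEdge H G₁ (suc ∘ f) p q → p ≢ suc w → p ≢ suc z → FreeEdge H G₂ (suc ∘ f) p q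
    keep₂ = FreeEdge-reroute G₁ 0≢1+n 0≢1+n
    wz-free₁ : FreeEdge H G₁ (suc ∘ f) (suc w) (suc z)
    wz-free₁ = keep₁ (FreeEdge-withIsolated wz-free) (suc-≢ (≢-sym u≢w)) (suc-≢ (≢-sym v≢w))
    degrees₂ : HasDegreeSequence (4 ∷ π) G₂
    degrees₂ = reroute-head-degrees {G = G₁}
      (reroute-head-degrees {G = G₀} (withIsolated-degrees {G = G} degrees)
        (suc-≢ u≢v) (FreeEdge.edge uv-free) 0≢1+n 0≢1+n refl refl)
      (suc-≢ w≢z) (FreeEdge.edge wz-free₁) 0≢1+n 0≢1+n
      (reroute-x-nonadjacent G₀ 0≢1+n 0≢1+n refl (suc-≢ (≢-sym u≢w)) (suc-≢ (≢-sym v≢w)))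
      (reroute-x-nonadjacent G₀ 0≢1+n 0≢1+n refl (suc-≢ (≢-sym u≢z)) (suc-≢ (≢-sym v≢z)))
    f-edge₂ : EdgePreserving H G₂ (suc ∘ f)
    f-edge₂ = EdgePreserving-reroute G₁ 0≢1+n 0≢1+n
      (EdgePreserving-reroute G₀ 0≢1+n 0≢1+n f-edge (FreeEdge-withIsolated uv-free)) wz-free₁

  reverse : ∀ {π} → FreePathRealization H π → FreePathRealization H π
  reverse R = record
    { G = G ; degrees = degrees ; f = f ; f-inj = f-inj ; f-edge = f-edge
    ; u = z ; v = w ; w = v ; z = u
    ; u≢v = ≢-sym w≢z ; u≢w = ≢-sym v≢z ; u≢z = ≢-sym u≢z
    ; v≢w = ≢-sym v≢w ; v≢z = ≢-sym u≢w ; w≢z = ≢-sym u≢v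
    ; uv-free = FreeEdge-sym wz-free ; vw-free = FreeEdge-sym vw-free ; wz-free = FreeEdge-sym uv-free
    }
    where open FreePathRealization R

  join-heads : ∀ {a b π} (R : FreePathRealization H (a ∷ b ∷ π)) →
    adj (FreePathRealization.G R) zero (suc zero) ≡ false → FreePathRealization H (suc a ∷ suc b ∷ π)
  join-heads {a} {b} {π} R 0≁1 = record
    { G = G′ ; degrees = degrees′ ; f = f ; f-inj = f-inj ; f-edge = λ a b a~b → addEdge-⊇ G 0≢1+n (f-edge a b a~b)
    ; u = u ; v = v ; w = w ; z = z
    ; u≢v = u≢v ; u≢w = u≢w ; u≢z = u≢z ; v≢w = v≢w ; v≢z = v≢z ; w≢z = w≢z
    ; uv-free = keep uv-free ; vw-free = keep vw-free ; wz-free = keep wz-free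
    }
    where
    open FreePathRealization R
    G′ : Graph (suc (suc (length π)))
    G′ = addEdge G zero (suc zero) 0≢1+n
    keep : ∀ {p q} → FreeEdge H G f p q → FreeEdge H G′ f p q
    keep (p~q , free) = addEdge-⊇ G 0≢1+n p~q , free
    degrees′ : HasDegreeSequence (suc a ∷ suc b ∷ π) G′
    degrees′ zero = trans (deg-addEdge G 0≢1+n 0≁1 zero) (trans (cong (_+ 1) (degrees zero)) (+-comm a 1))
    degrees′ (suc zero) =
      trans (deg-addEdge G 0≢1+n 0≁1 (suc zero)) (trans (cong (_+ 1) (degrees (suc zero))) (+-comm b 1))
    degrees′ (suc (suc p)) =
      trans (deg-addEdge G 0≢1+n 0≁1 (suc (suc p))) (trans (+-identityʳ _) (degrees (suc (suc p))))

  -- Two new vertices subdivide uv and wz and are then joined; the second is adjacent only to w and z.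
  extend₃₃ : ∀ {π} → FreePathRealization H π → FreePathRealization H (3 ∷ 3 ∷ π)
  extend₃₃ {π} R = join-heads (extend₂ R₁)
    (reroute-x-nonadjacent (withIsolated G) {zero} {suc w} {suc z} (λ ()) (λ ()) {suc zero} refl (λ ()) (λ ()))
    where
    R₁ : FreePathRealization H (2 ∷ π)
    R₁ = reverse (extend₂ (reverse R))
    open FreePathRealization R₁

potentiallyGraphic-↭ : ∀ {m} {H : Graph m} {π ρ} → PotentiallyGraphic H π → π ↭ ρ → PotentiallyGraphic H ρ
potentiallyGraphic-↭ {H = H} {π} {ρ} (G , degrees , f , f-inj , f-edge) π↭ρ =
  G′ , degrees′ , (σ ⟨$⟩ʳ_) ∘ f , f-inj ∘ σ-inj , f-edge′
  where
  σ : Permutation (length π) (length ρ)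
  σ = onIndices (↭⇒↭ₛ π↭ρ)
  σ-inj : ∀ {i j} → σ ⟨$⟩ʳ i ≡ σ ⟨$⟩ʳ j → i ≡ j
  σ-inj {i} {j} eq = trans (sym (inverseˡ σ)) (trans (cong (σ ⟨$⟩ˡ_) eq) (inverseˡ σ))
  G′ : Graph (length ρ)
  G′ = record
    { adj        = λ p q → adj G (σ ⟨$⟩ˡ p) (σ ⟨$⟩ˡ q)
    ; adj-sym    = λ p q → adj-sym G (σ ⟨$⟩ˡ p) (σ ⟨$⟩ˡ q)
    ; adj-irrefl = λ p → adj-irrefl G (σ ⟨$⟩ˡ p)
    }
  degrees′ : HasDegreeSequence ρ G′
  degrees′ p = begin
    deg G′ p
      ≡⟨ deg≡∑ G′ p ⟩
    ∑[ q < length ρ ] Bool→ℕ (adj G (σ ⟨$⟩ˡ p) (σ ⟨$⟩ˡ q))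
      ≡⟨ ∑-permute (λ r → Bool→ℕ (adj G (σ ⟨$⟩ˡ p) r)) (Perm.flip σ) ⟨
    ∑[ r < length π ] Bool→ℕ (adj G (σ ⟨$⟩ˡ p) r)
      ≡⟨ deg≡∑ G (σ ⟨$⟩ˡ p) ⟨
    deg G (σ ⟨$⟩ˡ p)
      ≡⟨ degrees (σ ⟨$⟩ˡ p) ⟩
    lookup π (σ ⟨$⟩ˡ p)
      ≡⟨ onIndices-lookup (↭⇒↭ₛ π↭ρ) (σ ⟨$⟩ˡ p) ⟩
    lookup ρ (σ ⟨$⟩ʳ (σ ⟨$⟩ˡ p))
      ≡⟨ cong (lookup ρ) (inverseʳ σ) ⟩
    lookup ρ p ∎
    where open ≡-Reasoning
  f-edge′ : EdgePreserving H G′ ((σ ⟨$⟩ʳ_) ∘ f)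
  f-edge′ a b a~b rewrite inverseˡ σ {f a} | inverseˡ σ {f b} = f-edge a b a~b

-- Realizations are only needed up to reordering of the degree sequence.
FreePathRealizable : ∀ {m} → Graph m → List ℕ → Set
FreePathRealizable H π = ∃ λ π′ → π′ ↭ π × FreePathRealization H π′

module _ {m} {H : Graph m} where

  realizable⇒potentiallyGraphic : ∀ {π} → FreePathRealizable H π → PotentiallyGraphic H π
  realizable⇒potentiallyGraphic (π′ , π′↭π , R) =
    potentiallyGraphic-↭ {H = H} (realization⇒potentiallyGraphic R) π′↭π

  realizable-4 : ∀ {i j k} → FreePathRealizable H (seq i j k) → FreePathRealizable H (seq (suc i) j k)
  realizable-4 {i} {j} {k} (π′ , π′↭ , R) =
    4 ∷ π′ , ↭-trans (prep 4 π′↭) (↭-sym (shift 4 (5 ∷ 5 ∷ []) (replicate i 4 ++ replicate j 3 ++ replicate k 2))) ,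
    extend₄ R

  realizable-33 : ∀ {i j k} → FreePathRealizable H (seq i j k) → FreePathRealizable H (seq i (2 + j) k)
  realizable-33 {i} {j} {k} (π′ , π′↭ , R) =
    3 ∷ 3 ∷ π′ , ↭-trans (prep 3 (prep 3 π′↭)) (↭-sym (↭-trans (shift 3 A (3 ∷ B)) (prep 3 (shift 3 A B)))) ,
    extend₃₃ R
    where
    A B : List ℕ
    A = 5 ∷ 5 ∷ replicate i 4
    B = replicate j 3 ++ replicate k 2

  realizable-2 : ∀ {i j k} → FreePathRealizable H (seq i j k) → FreePathRealizable H (seq i j (suc k))
  realizable-2 {i} {j} {k} (π′ , π′↭ , R) =
    2 ∷ π′ , ↭-trans (prep 2 π′↭) (↭-trans (↭-sym (shift 2 A (B ++ C))) (++⁺ˡ A (↭-sym (shift 2 B C)))) ,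
    extend₂ R
    where
    A B C : List ℕ
    A = 5 ∷ 5 ∷ replicate i 4
    B = replicate j 3
    C = replicate k 2

  realizable-+ : ∀ {i j k} a b c → FreePathRealizable H (seq i j k) →
    FreePathRealizable H (seq (a + i) (b * 2 + j) (c + k))
  realizable-+ {i} {j} {k} (suc a) b c R = realizable-4 {a + i} {b * 2 + j} {c + k} (realizable-+ {i} {j} {k} a b c R)
  realizable-+ {i} {j} {k} zero (suc b) c R = realizable-33 {i} {b * 2 + j} {c + k} (realizable-+ {i} {j} {k} zero b c R)
  realizable-+ {i} {j} {k} zero zero (suc c) R = realizable-2 {i} {j} {c + k} (realizable-+ {i} {j} {k} zero zero c R)
  realizable-+ zero zero zero R = R

  grow : ∀ i j k → FreePathRealizable H (seq i j k) → ∀ a b c → PotentiallyGraphic H (seq (i + a) (j + b * 2) (k + c))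
  grow i j k R a b c rewrite +-comm i a | +-comm j (b * 2) | +-comm k c =
    realizable⇒potentiallyGraphic (realizable-+ {i} {j} {k} a b c R)

==-sym : ∀ {n} (p q : Fin n) → p == q ≡ q == p
==-sym p q with p ≟ᶠ q | q ≟ᶠ p
... | yes _ | yes _ = refl
... | no _ | no _ = refl
... | yes p≡q | no q≢p = ⊥-elim (q≢p (sym p≡q))
... | no p≢q | yes q≡p = ⊥-elim (p≢q (sym q≡p))

==-refl : ∀ {n} (p : Fin n) → p == p ≡ true
==-refl p with p ≟ᶠ p
... | yes _ = refl
... | no p≢p = ⊥-elim (p≢p refl)

fromEdges : (n : ℕ) → List (ℕ × ℕ) → Graph n
fromEdges n es = record
  { adj        = λ p q → not (p == q) ∧ (listed p q ∨ listed q p)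
  ; adj-sym    = λ p q → cong₂ (λ s t → not s ∧ t) (==-sym p q) (∨-comm (listed p q) (listed q p))
  ; adj-irrefl = λ p → cong (λ s → not s ∧ (listed p p ∨ listed p p)) (==-refl p)
  }
  where
  listed : Fin n → Fin n → Bool
  listed p q = any (λ (a , b) → (a ≡ᵇ toℕ p) ∧ (b ≡ᵇ toℕ q)) es

K6-C5-edges : List (ℕ × ℕ)
K6-C5-edges = (0 , 1) ∷ (0 , 2) ∷ (0 , 3) ∷ (0 , 4) ∷ (0 , 5) ∷ (1 , 3) ∷ (1 , 4) ∷ (2 , 4) ∷ (2 , 5) ∷ (3 , 5) ∷ []

module _ {m} {H : Graph m} (π : List ℕ) (G : Graph (length π)) (f : Fin m → Fin (length π)) where

  private
    _≟²_ : (p q : Fin (length π) × Fin (length π)) → Dec (p ≡ q)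
    _≟²_ = ≡-dec _≟ᶠ_ _≟ᶠ_

    degrees? : Dec (HasDegreeSequence π G)
    degrees? = all? λ v → deg G v ≟ℕ lookup π v

    injective? : Dec (∀ a b → f a ≡ f b → a ≡ b)
    injective? = all? λ a → all? λ b → (f a ≟ᶠ f b) →-dec (a ≟ᶠ b)

    edgePreserving? : Dec (EdgePreserving H G f)
    edgePreserving? = all? λ a → all? λ b → (adj H a b ≟ᵇ true) →-dec (adj G (f a) (f b) ≟ᵇ true)

    freeEdge? : ∀ x y → Dec (FreeEdge H G f x y)
    freeEdge? x y = map′ (λ (e , n) → e , n) (λ fe → FreeEdge.edge fe , FreeEdge.not-image fe)
      ((adj G x y ≟ᵇ true) ×-dec (all? λ a → all? λ b → (adj H a b ≟ᵇ true) →-dec ¬? ((f a , f b) ≟² (x , y))))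

    embedding? : Dec (HasDegreeSequence π G × (∀ a b → f a ≡ f b → a ≡ b) × EdgePreserving H G f)
    embedding? = degrees? ×-dec injective? ×-dec edgePreserving?

    freePath? : (u v w z : Fin (length π)) → Dec (u ≢ v × u ≢ w × u ≢ z × v ≢ w × v ≢ z × w ≢ z ×
      FreeEdge H G f u v × FreeEdge H G f v w × FreeEdge H G f w z)
    freePath? u v w z = ¬? (u ≟ᶠ v) ×-dec ¬? (u ≟ᶠ w) ×-dec ¬? (u ≟ᶠ z) ×-dec ¬? (v ≟ᶠ w) ×-dec ¬? (v ≟ᶠ z)
      ×-dec ¬? (w ≟ᶠ z) ×-dec freeEdge? u v ×-dec freeEdge? v w ×-dec freeEdge? w z

  checkedPotentiallyGraphic : {True embedding?} → PotentiallyGraphic H π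
  checkedPotentiallyGraphic {ok} with toWitness ok
  ... | degrees , f-inj , f-edge = G , degrees , f , (λ {a} {b} → f-inj a b) , f-edge

  checkedRealization : (u v w z : Fin (length π)) → {True embedding?} → {True (freePath? u v w z)} →
    FreePathRealizable H π
  checkedRealization u v w z {ok} {path} with toWitness ok | toWitness path
  ... | degrees , f-inj , f-edge | u≢v , u≢w , u≢z , v≢w , v≢z , w≢z , uv-free , vw-free , wz-free =
    π , ↭-refl , record
      { G = G ; degrees = degrees ; f = f ; f-inj = λ {a} {b} → f-inj a b ; f-edge = f-edge
      ; u = u ; v = v ; w = w ; z = z
      ; u≢v = u≢v ; u≢w = u≢w ; u≢z = u≢z ; v≢w = v≢w ; v≢z = v≢z ; w≢z = w≢z
      ; uv-free = uv-free ; vw-free = vw-free ; wz-free = wz-free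
      }

realizable-5,0,0 : FreePathRealizable K6-C5 (seq 5 0 0)
realizable-5,0,0 = checkedRealization (seq 5 0 0)
  (fromEdges 7 (K6-C5-edges ++ (1 , 2) ∷ (1 , 6) ∷ (3 , 6) ∷ (4 , 6) ∷ (5 , 6) ∷ []))
  (_↑ˡ 1) (# 2) (# 1) (# 6) (# 3)

realizable-3,2,0 : FreePathRealizable K6-C5 (seq 3 2 0)
realizable-3,2,0 = checkedRealization (seq 3 2 0)
  (fromEdges 7 (K6-C5-edges ++ (1 , 2) ∷ (1 , 6) ∷ (3 , 6) ∷ (4 , 6) ∷ []))
  (_↑ˡ 1) (# 2) (# 1) (# 6) (# 3)

realizable-4,0,1 : FreePathRealizable K6-C5 (seq 4 0 1)
realizable-4,0,1 = checkedRealization (seq 4 0 1)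
  (fromEdges 7 (K6-C5-edges ++ (1 , 2) ∷ (1 , 6) ∷ (3 , 4) ∷ (5 , 6) ∷ []))
  (_↑ˡ 1) (# 2) (# 1) (# 6) (# 5)

realizable-2,4,0 : FreePathRealizable K6-C5 (seq 2 4 0)
realizable-2,4,0 = checkedRealization (seq 2 4 0)
  (fromEdges 8 (K6-C5-edges ++ (1 , 6) ∷ (1 , 7) ∷ (2 , 6) ∷ (3 , 7) ∷ (6 , 7) ∷ []))
  (_↑ˡ 2) (# 1) (# 6) (# 7) (# 3)

realizable-2,2,1 : FreePathRealizable K6-C5 (seq 2 2 1)
realizable-2,2,1 = checkedRealization (seq 2 2 1)
  (fromEdges 7 (K6-C5-edges ++ (1 , 2) ∷ (1 , 6) ∷ (3 , 6) ∷ []))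
  (_↑ˡ 1) (# 2) (# 1) (# 6) (# 3)

realizable-1,6,0 : FreePathRealizable K6-C5 (seq 1 6 0)
realizable-1,6,0 = checkedRealization (seq 1 6 0)
  (fromEdges 9 (K6-C5-edges ++ (1 , 6) ∷ (1 , 7) ∷ (2 , 8) ∷ (6 , 7) ∷ (6 , 8) ∷ (7 , 8) ∷ []))
  (_↑ˡ 3) (# 1) (# 6) (# 7) (# 8)

realizable-1,4,1 : FreePathRealizable K6-C5 (seq 1 4 1)
realizable-1,4,1 = checkedRealization (seq 1 4 1)
  (fromEdges 8 (K6-C5-edges ++ (1 , 6) ∷ (1 , 7) ∷ (2 , 6) ∷ (6 , 7) ∷ []))
  (_↑ˡ 2) (# 1) (# 7) (# 6) (# 2)

realizable-0,8,0 : FreePathRealizable K6-C5 (seq 0 8 0)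
realizable-0,8,0 = checkedRealization (seq 0 8 0)
  (fromEdges 10 (K6-C5-edges ++ (1 , 6) ∷ (1 , 7) ∷ (6 , 8) ∷ (6 , 9) ∷ (7 , 8) ∷ (7 , 9) ∷ (8 , 9) ∷ []))
  (_↑ˡ 4) (# 1) (# 6) (# 8) (# 7)

realizable-0,4,3 : FreePathRealizable K6-C5 (seq 0 4 3)
realizable-0,4,3 = checkedRealization (seq 0 4 3)
  (fromEdges 9 (K6-C5-edges ++ (1 , 6) ∷ (1 , 7) ∷ (6 , 8) ∷ (7 , 8) ∷ []))
  (_↑ˡ 3) (# 1) (# 6) (# 8) (# 7)

realizable-0,6,1 : FreePathRealizable K6-C5 (seq 0 6 1)
realizable-0,6,1 = checkedRealization (seq 0 6 1)
  (fromEdges 9 (K6-C5-edges ++ (1 , 6) ∷ (1 , 7) ∷ (6 , 7) ∷ (6 , 8) ∷ (7 , 8) ∷ []))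
  (_↑ˡ 3) (# 1) (# 6) (# 7) (# 8)

potentiallyGraphic-4,0,0 : PotentiallyGraphic K6-C5 (seq 4 0 0)
potentiallyGraphic-4,0,0 = checkedPotentiallyGraphic {H = K6-C5} (seq 4 0 0)
  (fromEdges 6 (K6-C5-edges ++ (1 , 2) ∷ (1 , 5) ∷ (3 , 4) ∷ []))
  (_↑ˡ 0)

potentiallyGraphic-2,2,0 : PotentiallyGraphic K6-C5 (seq 2 2 0)
potentiallyGraphic-2,2,0 = checkedPotentiallyGraphic {H = K6-C5} (seq 2 2 0)
  (fromEdges 6 ((0 , 1) ∷ (0 , 2) ∷ (0 , 3) ∷ (0 , 4) ∷ (0 , 5) ∷ (1 , 2) ∷ (1 , 3) ∷ (1 , 4) ∷ (1 , 5) ∷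
                (2 , 3) ∷ (2 , 5) ∷ (3 , 4) ∷ []))
  (Vec.lookup (# 0 ∷ # 1 ∷ # 2 ∷ # 4 ∷ # 5 ∷ # 3 ∷ []))

potentiallyGraphic-0,4,2 : PotentiallyGraphic K6-C5 (seq 0 4 2)
potentiallyGraphic-0,4,2 = checkedPotentiallyGraphic {H = K6-C5} (seq 0 4 2)
  (fromEdges 8 (K6-C5-edges ++ (1 , 6) ∷ (1 , 7) ∷ (6 , 7) ∷ []))
  (_↑ˡ 2)

exceptions : List (List ℕ)
exceptions = seq 0 4 0 ∷ seq 0 4 1 ∷ seq 0 6 0 ∷ seq 1 4 0 ∷ []

exception-not-potentiallyGraphic : ∀ {π} → π ∈ exceptions → ¬ PotentiallyGraphic K6-C5 π
exception-not-potentiallyGraphic (here refl) = ¬potentially-5²3⁴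
exception-not-potentiallyGraphic (there (here refl)) = ¬potentially-5²3⁴2
exception-not-potentiallyGraphic (there (there (here refl))) = ¬potentially-5²3⁶
exception-not-potentiallyGraphic (there (there (there (here refl)))) = ¬potentially-5²43⁴

potentiallyGraphic-even : ∀ i m k → 4 ≤ i + m * 2 → seq i (m * 2) k ∉ exceptions →
  PotentiallyGraphic K6-C5 (seq i (m * 2) k)
potentiallyGraphic-even (suc (suc (suc (suc (suc a))))) m k _ _ = grow 5 0 0 realizable-5,0,0 a m k
potentiallyGraphic-even 4 0 0 _ _ = potentiallyGraphic-4,0,0
potentiallyGraphic-even 4 0 (suc c) _ _ = grow 4 0 1 realizable-4,0,1 0 0 c
potentiallyGraphic-even 4 (suc b) k _ _ = grow 3 2 0 realizable-3,2,0 1 b k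
potentiallyGraphic-even 3 0 k (s≤s (s≤s (s≤s ()))) _
potentiallyGraphic-even 3 (suc b) k _ _ = grow 3 2 0 realizable-3,2,0 0 b k
potentiallyGraphic-even 2 0 k (s≤s (s≤s ())) _
potentiallyGraphic-even 2 1 0 _ _ = potentiallyGraphic-2,2,0
potentiallyGraphic-even 2 1 (suc c) _ _ = grow 2 2 1 realizable-2,2,1 0 0 c
potentiallyGraphic-even 2 (suc (suc b)) k _ _ = grow 2 4 0 realizable-2,4,0 0 b k
potentiallyGraphic-even 1 0 k (s≤s ()) _
potentiallyGraphic-even 1 1 k (s≤s (s≤s (s≤s ()))) _
potentiallyGraphic-even 1 2 0 _ ∉ = ⊥-elim (∉ (there (there (there (here refl)))))
potentiallyGraphic-even 1 2 (suc c) _ _ = grow 1 4 1 realizable-1,4,1 0 0 c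
potentiallyGraphic-even 1 (suc (suc (suc b))) k _ _ = grow 1 6 0 realizable-1,6,0 0 b k
potentiallyGraphic-even 0 0 k () _
potentiallyGraphic-even 0 1 k (s≤s (s≤s ())) _
potentiallyGraphic-even 0 2 0 _ ∉ = ⊥-elim (∉ (here refl))
potentiallyGraphic-even 0 2 1 _ ∉ = ⊥-elim (∉ (there (here refl)))
potentiallyGraphic-even 0 2 2 _ _ = potentiallyGraphic-0,4,2
potentiallyGraphic-even 0 2 (suc (suc (suc c))) _ _ = grow 0 4 3 realizable-0,4,3 0 0 c
potentiallyGraphic-even 0 3 0 _ ∉ = ⊥-elim (∉ (there (there (here refl))))
potentiallyGraphic-even 0 3 (suc c) _ _ = grow 0 6 1 realizable-0,6,1 0 0 c
potentiallyGraphic-even 0 (suc (suc (suc (suc b)))) k _ _ = grow 0 8 0 realizable-0,8,0 0 b k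

sum-replicate : ∀ r x → sum (replicate r x) ≡ r * x
sum-replicate zero x = refl
sum-replicate (suc r) x = cong (x +_) (sum-replicate r x)

sum-seq : ∀ i j k → sum (seq i j k) ≡ j + (5 + i * 2 + j + k) * 2
sum-seq i j k = begin
  sum (seq i j k)
    ≡⟨ cong (λ s → 5 + (5 + s))
         (trans (sum-++ (replicate i 4) _) (cong (sum (replicate i 4) +_) (sum-++ (replicate j 3) _))) ⟩
  5 + (5 + (sum (replicate i 4) + (sum (replicate j 3) + sum (replicate k 2))))
    ≡⟨ cong₂ (λ s t → 5 + (5 + (s + t))) (sum-replicate i 4) (cong₂ _+_ (sum-replicate j 3) (sum-replicate k 2)) ⟩
  5 + (5 + (i * 4 + (j * 3 + k * 2)))
    ≡⟨ arithmetic i j k ⟩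
  j + (5 + i * 2 + j + k) * 2 ∎
  where
  open ≡-Reasoning
  arithmetic : ∀ i j k → 5 + (5 + (i * 4 + (j * 3 + k * 2))) ≡ j + (5 + i * 2 + j + k) * 2
  arithmetic = solve-∀

sum-seq-parity : ∀ i j k → sum (seq i j k) % 2 ≡ j % 2
sum-seq-parity i j k = trans (cong (_% 2) (sum-seq i j k)) ([m+kn]%n≡m%n j (5 + i * 2 + j + k) 2)

even-sum⇒even : ∀ i j k → sum (seq i j k) % 2 ≡ 0 → ∃ λ m → j ≡ m * 2
even-sum⇒even i j k even = j / 2 , trans (m≡m%n+[m/n]*n j 2) (cong (_+ j / 2 * 2) (trans (sym (sum-seq-parity i j k)) even))

potentiallyGraphic-seq : ∀ i j k → 4 ≤ i + j → sum (seq i j k) % 2 ≡ 0 → seq i j k ∉ exceptions →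
  PotentiallyGraphic K6-C5 (seq i j k)
potentiallyGraphic-seq i j k 4≤i+j even with even-sum⇒even i j k even
... | m , refl = potentiallyGraphic-even i m k 4≤i+j

lemma2p8 : (n i j : ℕ) → n ≥ 6 → i + j ≥ 4 → i + j ≤ n ∸ 2 →
    sum (seq i j (n ∸ 2 ∸ i ∸ j)) % 2 ≡ 0 →
    (PotentiallyGraphic K6-C5 (seq i j (n ∸ 2 ∸ i ∸ j)) ⇔
     seq i j (n ∸ 2 ∸ i ∸ j) ∉ ((5 ∷ 5 ∷ 3 ∷ 3 ∷ 3 ∷ 3 ∷ []) ∷ (5 ∷ 5 ∷ 3 ∷ 3 ∷ 3 ∷ 3 ∷ 2 ∷ []) ∷ (5 ∷ 5 ∷ 3 ∷ 3 ∷ 3 ∷ 3 ∷ 3 ∷ 3 ∷ []) ∷ (5 ∷ 5 ∷ 4 ∷ 3 ∷ 3 ∷ 3 ∷ 3 ∷ []) ∷ []))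
lemma2p8 n i j _ i+j≥4 _ even =
  mk⇔ (λ graphic exceptional → exception-not-potentiallyGraphic exceptional graphic)
      (potentiallyGraphic-seq i j (n ∸ 2 ∸ i ∸ j) i+j≥4 even)
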